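{- Let $G$ be a group, let $L,R$ be nonempty subsets of $G$, and let $K$ be a retract of $G$ under a retraction $\phi$. Then $2\mathrm{S}(G;L,R)$ is weakly connected if and only if $2\mathrm{S}(K;\phi(L),\phi(R))$ is weakly connected and $\ker\phi$ is weakly connected within $2\mathrm{S}(G;L,R)$.
   Context: For a group $G$ and nonempty subsets $L,R\subseteq G$, the two-sided group digraph $2\mathrm{S}(G;L,R)$ has vertex set $G$ and a directed arc $(g,h)$ if and only if $h=l^{ -1}gr$ for some $l\in L$, $r\in R$. Vertex $g$ is weakly connected to $h$ if there is a sequence $g=g_0,\dots,g_n=h$ such that for each $i$ either $(g_{i-1},g_i)$ or $(g_i,g_{i-1})$ is an arc; a digraph is weakly connected if every pair of vertices is weakly connected. A subset $H\subseteq G$ is weakly connected within $2\mathrm{S}(G;L,R)$ if every two elements of $H$ are weakly connected in $2\mathrm{S}(G;L,R)$ (the connecting paths may pass through vertices outside $H$). A subgroup $K$ of $G$ is a retract of $G$ with retraction $\phi$ if $\phi:G\to G$ is a group homomorphism with $\phi(g)\in K$ for all $g\in G$ and $\phi(k)=k$ for all $k\in K$. -}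

module Defs where

open import Level using (Level; _⊔_)
open import Algebra.Bundles using (Group)
open import Algebra.Morphism.Structures using (module GroupMorphisms)
open import Data.Product using (Σ; ∃; _×_; _,_; proj₁)
open import Relation.Unary using (Pred; _∈_)
open import Relation.Binary.Construct.Closure.Equivalence using (EqClosure)

module _ {c ℓ : Level} (G : Group c ℓ) where
  open Group G

  Nonempty : ∀ {p} → Pred Carrier p → Set (c ⊔ p)
  Nonempty S = ∃ λ x → x ∈ S

  Arc : ∀ {p q} → Pred Carrier p → Pred Carrier q → Carrier → Carrier → Set (c ⊔ ℓ ⊔ p ⊔ q)
  Arc L R g h = ∃ λ l → ∃ λ r → l ∈ L × r ∈ R × (h ≈ ((l ⁻¹) ∙ g) ∙ r)

  WeaklyConnectedTo : ∀ {p q} → Pred Carrier p → Pred Carrier q → Carrier → Carrier → Set (c ⊔ ℓ ⊔ p ⊔ q)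
  WeaklyConnectedTo L R = EqClosure (Arc L R)

  WeaklyConnected : ∀ {p q} → Pred Carrier p → Pred Carrier q → Set (c ⊔ ℓ ⊔ p ⊔ q)
  WeaklyConnected L R = ∀ g h → WeaklyConnectedTo L R g h

  WeaklyConnectedWithin : ∀ {p q r} → Pred Carrier p → Pred Carrier q → Pred Carrier r → Set (c ⊔ ℓ ⊔ p ⊔ q ⊔ r)
  WeaklyConnectedWithin L R H = ∀ g h → g ∈ H → h ∈ H → WeaklyConnectedTo L R g h

  record IsSubgroup {k} (K : Pred Carrier k) : Set (c ⊔ ℓ ⊔ k) where
    field
      resp-≈ : ∀ {x y} → x ≈ y → x ∈ K → y ∈ K
      ε-mem  : ε ∈ K
      ∙-mem  : ∀ {x y} → x ∈ K → y ∈ K → (x ∙ y) ∈ K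
      ⁻¹-mem : ∀ {x} → x ∈ K → (x ⁻¹) ∈ K

  open GroupMorphisms rawGroup rawGroup using (IsGroupHomomorphism)

  record IsRetraction {k} (K : Pred Carrier k) (φ : Carrier → Carrier) : Set (c ⊔ ℓ ⊔ k) where
    field
      isGroupHomomorphism : IsGroupHomomorphism φ
      into  : ∀ g → φ g ∈ K
      fixes : ∀ x → x ∈ K → φ x ≈ x

  Image : ∀ {p} → (Carrier → Carrier) → Pred Carrier p → Pred Carrier (c ⊔ ℓ ⊔ p)
  Image φ S y = ∃ λ x → x ∈ S × (y ≈ φ x)

  Ker : (Carrier → Carrier) → Pred Carrier ℓ
  Ker φ x = φ x ≈ ε

  ArcSub : ∀ {k p q} (K : Pred Carrier k) → Pred Carrier p → Pred Carrier q →
           Σ Carrier K → Σ Carrier K → Set (c ⊔ ℓ ⊔ p ⊔ q)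
  ArcSub K L R a b = Arc L R (proj₁ a) (proj₁ b)

  WeaklyConnectedSub : ∀ {k p q} (K : Pred Carrier k) → Pred Carrier p → Pred Carrier q → Set (c ⊔ ℓ ⊔ k ⊔ p ⊔ q)
  WeaklyConnectedSub K L R = ∀ (a b : Σ Carrier K) → EqClosure (ArcSub K L R) a b

module Submission where

-- The proof rests on the fact that a group endomorphism φ is a "fibration"
-- of two-sided group digraphs: every arc of 2S(G;L,R) maps to an arc of the
-- digraph with connection sets φ(L), φ(R) (arc-image), and conversely every
-- arc of the image digraph, traversed in either direction, lifts to an arc
-- of 2S(G;L,R) starting at any prescribed vertex over its start (lift-out,
-- lift-in, hence path-lift).  Since vertices of 2S(K;…) are elements of K
-- compared by identity while arcs only see ≈, we also need that ≈-related
-- vertices of 2S(K;L',R') are connected whenever L' and R' meet K.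
-- Forward direction: push a path from a to b through φ (φ fixes K).
-- Backward direction: lift a path in 2S(K;…) from φ g to ε, landing at a
-- point of ker φ, which is connected to ε inside 2S(G;L,R).

open import Defs
open import Level using (Level; _⊔_)
open import Algebra.Bundles using (Group)
open import Algebra.Morphism.Structures using (module GroupMorphisms)
open import Data.Product using (_×_; _,_; proj₁; proj₂; Σ; ∃)
open import Relation.Unary using (Pred; _∈_)
open import Function.Bundles using (_⇔_; mk⇔)
open import Relation.Binary.Construct.Closure.ReflexiveTransitive using (ε; _◅_; _◅◅_)
open import Relation.Binary.Construct.Closure.Symmetric using (fwd; bwd)
open import Relation.Binary.Construct.Closure.Equivalence as EqClosure using (EqClosure)
import Relation.Binary.Reasoning.Setoid as SetoidReasoning

module _ {c ℓ : Level} (G : Group c ℓ) where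
  open Group G renaming (ε to e)
  open SetoidReasoning setoid

  -- Multiplying g by mutually inverse pairs on both sides gives back g.
  -- Both instances needed below (l⁻¹, l and l, l⁻¹) are the two ways of
  -- undoing the arc operation g ↦ l⁻¹ g r.
  cancel-sides : ∀ {a b c d} → a ∙ b ≈ e → c ∙ d ≈ e → ∀ g → (a ∙ ((b ∙ g) ∙ c)) ∙ d ≈ g
  cancel-sides {a} {b} {c} {d} ab≈e cd≈e g = begin
    (a ∙ ((b ∙ g) ∙ c)) ∙ d ≈⟨ assoc _ _ _ ⟩
    a ∙ (((b ∙ g) ∙ c) ∙ d) ≈⟨ ∙-congˡ (assoc _ _ _) ⟩
    a ∙ ((b ∙ g) ∙ (c ∙ d)) ≈⟨ ∙-congˡ (∙-congˡ cd≈e) ⟩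
    a ∙ ((b ∙ g) ∙ e)       ≈⟨ ∙-congˡ (identityʳ _) ⟩
    a ∙ (b ∙ g)             ≈⟨ sym (assoc _ _ _) ⟩
    (a ∙ b) ∙ g             ≈⟨ ∙-congʳ ab≈e ⟩
    e ∙ g                   ≈⟨ identityˡ g ⟩
    g                       ∎

  module Lifting {p q} {L : Pred Carrier p} {R : Pred Carrier q}
                 {φ : Carrier → Carrier}
                 (isHom : GroupMorphisms.IsGroupHomomorphism rawGroup rawGroup φ) where
    open GroupMorphisms.IsGroupHomomorphism isHom using (homo; ⁻¹-homo; ⟦⟧-cong)

    φL : Pred Carrier (c ⊔ ℓ ⊔ p)
    φL = Image G φ L

    φR : Pred Carrier (c ⊔ ℓ ⊔ q)
    φR = Image G φ R

    homo₃ : ∀ a b d → φ ((a ∙ b) ∙ d) ≈ (φ a ∙ φ b) ∙ φ d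
    homo₃ a b d = trans (homo _ _) (∙-congʳ (homo a b))

    arc-image : ∀ {g h} → Arc G L R g h → Arc G φL φR (φ g) (φ h)
    arc-image {g} (l , r , l∈L , r∈R , h≈) =
      φ l , φ r , (l , l∈L , refl) , (r , r∈R , refl) ,
      trans (⟦⟧-cong h≈) (trans (homo₃ _ g r) (∙-congʳ (∙-congʳ (⁻¹-homo l))))

    lift-out : ∀ {x y g} → Arc G φL φR x y → φ g ≈ x →
               ∃ λ g' → Arc G L R g g' × φ g' ≈ y
    lift-out {x} {y} {g} (l' , r' , (l , l∈L , l'≈) , (r , r∈R , r'≈) , y≈) φg≈x =
      ((l ⁻¹) ∙ g) ∙ r , (l , r , l∈L , r∈R , refl) , (begin
        φ (((l ⁻¹) ∙ g) ∙ r)       ≈⟨ homo₃ _ g r ⟩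
        (φ (l ⁻¹) ∙ φ g) ∙ φ r     ≈⟨ ∙-congʳ (∙-congʳ (⁻¹-homo l)) ⟩
        ((φ l ⁻¹) ∙ φ g) ∙ φ r     ≈⟨ ∙-cong (∙-cong (⁻¹-cong (sym l'≈)) φg≈x) (sym r'≈) ⟩
        ((l' ⁻¹) ∙ x) ∙ r'         ≈⟨ sym y≈ ⟩
        y                          ∎)

    lift-in : ∀ {x y g} → Arc G φL φR x y → φ g ≈ y →
              ∃ λ g' → Arc G L R g' g × φ g' ≈ x
    lift-in {x} {y} {g} (l' , r' , (l , l∈L , l'≈) , (r , r∈R , r'≈) , y≈) φg≈y =
      (l ∙ g) ∙ (r ⁻¹) ,
      (l , r , l∈L , r∈R , sym (cancel-sides (inverseˡ l) (inverseˡ r) g)) , (begin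
        φ ((l ∙ g) ∙ (r ⁻¹))          ≈⟨ homo₃ l g _ ⟩
        (φ l ∙ φ g) ∙ φ (r ⁻¹)        ≈⟨ ∙-congˡ (⁻¹-homo r) ⟩
        (φ l ∙ φ g) ∙ (φ r ⁻¹)        ≈⟨ ∙-cong (∙-cong (sym l'≈) (trans φg≈y y≈)) (⁻¹-cong (sym r'≈)) ⟩
        (l' ∙ (((l' ⁻¹) ∙ x) ∙ r')) ∙ (r' ⁻¹) ≈⟨ cancel-sides (inverseʳ l') (inverseʳ r') x ⟩
        x                             ∎)

    path-lift : ∀ {x y} → WeaklyConnectedTo G φL φR x y → ∀ {g} → φ g ≈ x →
                ∃ λ g' → WeaklyConnectedTo G L R g g' × φ g' ≈ y
    path-lift ε {g} φg≈x = g , ε , φg≈x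
    path-lift (fwd arc ◅ path) φg≈x with lift-out arc φg≈x
    ... | g₁ , arc′ , φg₁≈ with path-lift path φg₁≈
    ...   | g' , path′ , φg'≈ = g' , fwd arc′ ◅ path′ , φg'≈
    path-lift (bwd arc ◅ path) φg≈x with lift-in arc φg≈x
    ... | g₁ , arc′ , φg₁≈ with path-lift path φg₁≈
    ...   | g' , path′ , φg'≈ = g' , bwd arc′ ◅ path′ , φg'≈

  -- In 2S(K;L',R') for a subgroup K, two vertices with ≈-equal underlying
  -- elements are connected, provided L' and R' both meet K: both have an arc
  -- into the common vertex l⁻¹ a r.
  ≈⇒connected-sub : ∀ {k p q} {K : Pred Carrier k} {L' : Pred Carrier p} {R' : Pred Carrier q} →
                    IsSubgroup G K → ∀ {l r} → l ∈ L' → l ∈ K → r ∈ R' → r ∈ K →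
                    ∀ (a b : Σ Carrier K) → proj₁ a ≈ proj₁ b →
                    EqClosure (ArcSub G K L' R') a b
  ≈⇒connected-sub {K = K} sub {l} {r} l∈L' l∈K r∈R' r∈K (a , a∈K) (b , b∈K) a≈b =
    fwd {b = meet} (l , r , l∈L' , r∈R' , refl) ◅
    bwd (l , r , l∈L' , r∈R' , ∙-congʳ (∙-congˡ a≈b)) ◅ ε
    where
    open IsSubgroup sub
    meet : Σ Carrier K
    meet = ((l ⁻¹) ∙ a) ∙ r , ∙-mem (∙-mem (⁻¹-mem l∈K) a∈K) r∈K

  module Retract {p q k} {L : Pred Carrier p} {R : Pred Carrier q}
                 {K : Pred Carrier k} {φ : Carrier → Carrier}
                 (neL : Nonempty G L) (neR : Nonempty G R)
                 (sub : IsSubgroup G K) (ret : IsRetraction G K φ) where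
    open IsSubgroup sub using (ε-mem)
    open IsRetraction ret
    open Lifting {L = L} {R = R} isGroupHomomorphism
    open GroupMorphisms.IsGroupHomomorphism isGroupHomomorphism using (ε-homo)

    ψ : Carrier → Σ Carrier K
    ψ g = φ g , into g

    ≈⇒connected : ∀ (a b : Σ Carrier K) → proj₁ a ≈ proj₁ b →
                  EqClosure (ArcSub G K φL φR) a b
    ≈⇒connected =
      ≈⇒connected-sub sub (l , proj₂ neL , refl) (into l) (r , proj₂ neR , refl) (into r)
      where
      l r : Carrier
      l = proj₁ neL
      r = proj₁ neR

    forget-K : ∀ {a b} → EqClosure (ArcSub G K φL φR) a b →
               WeaklyConnectedTo G φL φR (proj₁ a) (proj₁ b)
    forget-K = EqClosure.gmap proj₁ (λ arc → arc)

    quotient-connected : WeaklyConnected G L R → WeaklyConnectedSub G K φL φR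
    quotient-connected wc a b =
      ≈⇒connected a (ψ (proj₁ a)) (sym (fixes _ (proj₂ a)))
      ◅◅ EqClosure.gmap ψ arc-image (wc (proj₁ a) (proj₁ b))
      ◅◅ ≈⇒connected (ψ (proj₁ b)) b (fixes _ (proj₂ b))

    connected-to-ε : WeaklyConnectedSub G K φL φR → WeaklyConnectedWithin G L R (Ker G φ) →
                     ∀ g → WeaklyConnectedTo G L R g e
    connected-to-ε wcK wcKer g with path-lift (forget-K (wcK (ψ g) (e , ε-mem))) refl
    ... | g' , g~g' , g'∈ker = g~g' ◅◅ wcKer g' e g'∈ker ε-homo

    connected-from-parts : WeaklyConnectedSub G K φL φR × WeaklyConnectedWithin G L R (Ker G φ) →
                           WeaklyConnected G L R
    connected-from-parts (wcK , wcKer) g h =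
      connected-to-ε wcK wcKer g ◅◅ EqClosure.symmetric (Arc G L R) (connected-to-ε wcK wcKer h)

proposition6p2 : ∀ {c ℓ p q k : Level} (G : Group c ℓ)
    (L : Pred (Group.Carrier G) p) (R : Pred (Group.Carrier G) q)
    (K : Pred (Group.Carrier G) k) (φ : Group.Carrier G → Group.Carrier G) →
    Nonempty G L → Nonempty G R →
    IsSubgroup G K → IsRetraction G K φ →
    WeaklyConnected G L R ⇔
    (WeaklyConnectedSub G K (Image G φ L) (Image G φ R)
    × WeaklyConnectedWithin G L R (Ker G φ))
proposition6p2 G L R K φ neL neR sub ret =
  mk⇔ (λ wc → quotient-connected wc , λ g h _ _ → wc g h) connected-from-parts
  where open Retract G neL neR sub ret
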